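{- Let $S$ be a finite $p\times q$ rectangular group over a group $G$. Then \[ \mu(S)=\min_{r\geq\mu(G)}\beta_r(p,q), \] where for $r\geq1$, $\beta_r(p,q)$ is the least $n$ such that the set $D_r(\mathcal T_n)=\{f\in\mathcal T_n:\operatorname{rank}(f)=r\}$ contains a subsemigroup isomorphic to a $p\times q$ rectangular band (with $\min\emptyset=\infty$).
   Context: $\mathcal T_n$ is the full transformation semigroup on $\{1,\dots,n\}$; the rank of a transformation is the size of its image. The degree $\mu(T)$ of a finite semigroup $T$ is the least $n\geq1$ such that $T$ embeds in $\mathcal T_n$. A $p\times q$ rectangular band is a semigroup $P\times Q$ with $|P|=p,|Q|=q$ and $(p_1,q_1)(p_2,q_2)=(p_1,q_2)$. A $p\times q$ rectangular group over $G$ is a direct product $B\times G$ with $B$ a $p\times q$ rectangular band and $G$ a group. -}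

module Defs where

open import Level using (Level; _⊔_)
open import Data.Nat using (ℕ; _≤_; _<_)
open import Data.Fin using (Fin)
open import Data.Fin.Properties using (_≟_)
open import Data.Fin.Subset using (Subset; ∣_∣)
open import Data.Fin.Properties using (any?)
open import Data.Vec using (tabulate)
open import Data.Product using (Σ; ∃; _×_; _,_; proj₁; proj₂)
open import Relation.Nullary using (does)
open import Relation.Binary.PropositionalEquality using (_≡_; _≗_)
open import Algebra.Bundles using (Group)

Trans : ℕ → Set
Trans n = Fin n → Fin n

-- Product in T_n, with transformations acting on the right:
-- x (f g) = (x f) g, i.e. first f, then g.
_⨾_ : ∀ {n} → Trans n → Trans n → Trans n
(f ⨾ g) x = g (f x)

image : ∀ {n} → Trans n → Subset n
image {n} f = tabulate (λ y → does (any? (λ x → f x ≟ y)))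

rank : ∀ {n} → Trans n → ℕ
rank f = ∣ image f ∣

record Embedding {a ℓ} {A : Set a} (_≈_ : A → A → Set ℓ) (_∙_ : A → A → A)
                 (n : ℕ) : Set (a ⊔ ℓ) where
  field
    φ          : A → Trans n
    φ-cong     : ∀ x y → x ≈ y → φ x ≗ φ y
    φ-injective : ∀ x y → φ x ≗ φ y → x ≈ y
    φ-hom      : ∀ x y → φ (x ∙ y) ≗ (φ x ⨾ φ y)

IsDegree : ∀ {a ℓ} {A : Set a} (_≈_ : A → A → Set ℓ) (_∙_ : A → A → A)
           → ℕ → Set (a ⊔ ℓ)
IsDegree _≈_ _∙_ m =
  (1 ≤ m) × Embedding _≈_ _∙_ m
  × (∀ n → 1 ≤ n → Embedding _≈_ _∙_ n → m ≤ n)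

RB : ℕ → ℕ → Set
RB p q = Fin p × Fin q

_∙RB_ : ∀ {p q} → RB p q → RB p q → RB p q
(i , _) ∙RB (_ , j) = i , j

RG : ∀ {c ℓ} → ℕ → ℕ → Group c ℓ → Set c
RG p q G = RB p q × Group.Carrier G

_≈RG_ : ∀ {c ℓ} {p q} {G : Group c ℓ} → RG p q G → RG p q G → Set ℓ
_≈RG_ {G = G} (b , g) (b′ , g′) = (b ≡ b′) × Group._≈_ G g g′

mulRG : ∀ {c ℓ} {p q} (G : Group c ℓ) → RG p q G → RG p q G → RG p q G
mulRG G (b , g) (b′ , g′) = (b ∙RB b′) , Group._∙_ G g g′

-- D_r(T_n) contains a subsemigroup isomorphic to the p × q rectangular band:
-- there is an injective homomorphism from the band into T_n all of whose
-- values have rank r (its image is then such a subsemigroup, and conversely).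
BandInDr : ℕ → ℕ → ℕ → ℕ → Set
BandInDr p q r n =
  Σ (Embedding {A = RB p q} _≡_ _∙RB_ n)
    (λ e → ∀ b → rank (Embedding.φ e b) ≡ r)

IsBeta : ℕ → ℕ → ℕ → ℕ → Set
IsBeta p q r n = BandInDr p q r n × (∀ k → BandInDr p q r k → n ≤ k)

-- m = min_{r ≥ μG} β_r(p,q), where β_r = ∞ when undefined (min ∅ = ∞,
-- so this can only hold for finite m if some β_r with r ≥ μG is finite).
IsMinBeta : ℕ → ℕ → ℕ → ℕ → Set
IsMinBeta μG p q m =
  (∃ λ r → (μG ≤ r) × IsBeta p q r m)
  × (∀ r b → μG ≤ r → IsBeta p q r b → m ≤ b)

FiniteGroup : ∀ {c ℓ} → Group c ℓ → Set (c ⊔ ℓ)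
FiniteGroup G =
  ∃ λ k → Σ (Fin k → Group.Carrier G) (λ f → ∀ g → ∃ λ i → Group._≈_ G (f i) g)

module Submission where

open import Defs
open import Data.Nat using (ℕ; zero; suc; _+_; _≤_; _<_; z≤n; s≤s; _≤?_)
open import Data.Nat.Properties using (≤-antisym; ≤-trans; ≮⇒≥; m≤n⇒∃[o]m+o≡n)
open import Data.Nat.Induction using (<-rec)
open import Data.Bool.Properties using (T-≡)
open import Data.Fin using (Fin; zero; suc; _↑ˡ_; splitAt; join)
open import Data.Fin.Properties using (_≟_; any?; suc-injective; toℕ<n; injective⇒≤; ↑ˡ-injective; splitAt-↑ˡ; splitAt-join; join-splitAt)
open import Data.Fin.Subset using (Subset; ∣_∣; _∈_; inside; outside)
open import Data.Fin.Subset.Properties using (∣p∣≤n; p⊆q⇒∣p∣≤∣q∣)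
open import Data.Vec using (_∷_; here; there; lookup)
open import Data.Vec.Properties using (lookup∘tabulate; []=⇒lookup; lookup⇒[]=)
open import Data.Sum using (map₁)
open import Data.Sum.Properties using (map-map; map-id; map₁-cong)
open import Data.Product using (Σ; ∃; _×_; _,_; proj₁; proj₂; uncurry)
open import Function using (id; _∘_; Equivalence)
open import Function.Bundles using (_⇔_; mk⇔)
open import Relation.Nullary using (¬_; does; isYes)
open import Relation.Nullary.Decidable using (toWitness; dec-true; isYes≗does; decidable-stable)
open import Relation.Binary.PropositionalEquality
open import Algebra.Bundles using (Group)

open ≡-Reasoning

-- An embedding Φ of B × G into T_n restricts to an embedding b ↦ Φ (b , 1) of the band, all
-- of whose values have one rank r (as b = b b′ b), and to g ↦ Φ (b₀ , g), which acts
-- faithfully on the r-point image of the idempotent Φ (b₀ , 1); so G embeds in T_r and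
-- μ(G) ≤ r. Conversely, given a band f in D_r(T_n) with r ≥ μ(G), G embeds in T_r with 1
-- acting as the identity, and inserting this action between the factors of
-- f (i , j) = f (i , j₀) f (i₀ , j) embeds B × G in T_n. Hence the n into which S embeds are
-- exactly those admitting some band in D_r(T_n) with r ≥ μ(G), and μ(S) is the least of them.

enum : ∀ {n} (p : Subset n) → Fin ∣ p ∣ → Fin n
enum (inside ∷ p) zero = zero
enum (inside ∷ p) (suc i) = suc (enum p i)
enum (outside ∷ p) i = suc (enum p i)

enum-∈ : ∀ {n} (p : Subset n) i → enum p i ∈ p
enum-∈ (inside ∷ p) zero = here
enum-∈ (inside ∷ p) (suc i) = there (enum-∈ p i)
enum-∈ (outside ∷ p) i = there (enum-∈ p i)

enum-injective : ∀ {n} (p : Subset n) {i j} → enum p i ≡ enum p j → i ≡ j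
enum-injective (inside ∷ p) {zero} {zero} _ = refl
enum-injective (inside ∷ p) {suc i} {suc j} eq = cong suc (enum-injective p (suc-injective eq))
enum-injective (outside ∷ p) eq = enum-injective p (suc-injective eq)

index : ∀ {n} (p : Subset n) {x} → x ∈ p → Fin ∣ p ∣
index (inside ∷ p) here = zero
index (inside ∷ p) (there x∈p) = suc (index p x∈p)
index (outside ∷ p) (there x∈p) = index p x∈p

enum-index : ∀ {n} (p : Subset n) {x} (x∈p : x ∈ p) → enum p (index p x∈p) ≡ x
enum-index (inside ∷ p) here = refl
enum-index (inside ∷ p) (there x∈p) = cong suc (enum-index p x∈p)
enum-index (outside ∷ p) (there x∈p) = cong suc (enum-index p x∈p)

module _ {n} (f : Trans n) where

  private
    lookup-image : ∀ y → lookup (image f) y ≡ does (any? (λ x → f x ≟ y))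
    lookup-image = lookup∘tabulate (λ y → does (any? (λ x → f x ≟ y)))

  ∈-image⁻ : ∀ {y} → y ∈ image f → ∃ λ x → f x ≡ y
  ∈-image⁻ {y} y∈ = toWitness {a? = found} (Equivalence.from T-≡ (begin
    isYes found         ≡⟨ isYes≗does found ⟩
    does found          ≡⟨ lookup-image y ⟨
    lookup (image f) y  ≡⟨ []=⇒lookup y∈ ⟩
    inside              ∎))
    where found = any? (λ x → f x ≟ y)

  ∈-image : ∀ x → f x ∈ image f
  ∈-image x = lookup⇒[]= (f x) (image f) (trans (lookup-image (f x)) (dec-true (any? _) (x , refl)))

  point : Fin (rank f) → Fin n
  point = enum (image f)

  coord : Fin n → Fin (rank f)
  coord x = index (image f) (∈-image x)

  point-coord : ∀ x → point (coord x) ≡ f x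
  point-coord x = enum-index (image f) (∈-image x)

  preimage : Fin (rank f) → Fin n
  preimage i = proj₁ (∈-image⁻ (enum-∈ (image f) i))

  preimage-point : ∀ i → f (preimage i) ≡ point i
  preimage-point i = proj₂ (∈-image⁻ (enum-∈ (image f) i))

rank≥1 : ∀ {n} (f : Trans n) → 1 ≤ n → 1 ≤ rank f
rank≥1 {suc n} f _ = ≤-trans (s≤s z≤n) (toℕ<n (coord f zero))

rank-≤ : ∀ {n} (f : Trans n) → rank f ≤ n
rank-≤ f = ∣p∣≤n (image f)

rank-≤ʳ : ∀ {n} {f g h : Trans n} → h ≗ f ⨾ g → rank h ≤ rank g
rank-≤ʳ {f = f} {g} {h} h≗f⨾g = p⊆q⇒∣p∣≤∣q∣ image-h⊆image-g
  where
  image-h⊆image-g : ∀ {y} → y ∈ image h → y ∈ image g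
  image-h⊆image-g y∈ with ∈-image⁻ h y∈
  ... | x , refl = subst (_∈ image g) (sym (h≗f⨾g x)) (∈-image g (f x))

rank-≤ˡ : ∀ {n} {f g h : Trans n} → h ≗ f ⨾ g → rank h ≤ rank f
rank-≤ˡ {f = f} {g} {h} h≗f⨾g = injective⇒≤ {f = coord f ∘ preimage h} injective
  where
  injective : ∀ {i j} → coord f (preimage h i) ≡ coord f (preimage h j) → i ≡ j
  injective {i} {j} eq = enum-injective (image h) (begin
    point h i              ≡⟨ sym (preimage-point h i) ⟩
    h (preimage h i)       ≡⟨ h≗f⨾g (preimage h i) ⟩
    g (f (preimage h i))   ≡⟨ cong g f-eq ⟩
    g (f (preimage h j))   ≡⟨ sym (h≗f⨾g (preimage h j)) ⟩
    h (preimage h j)       ≡⟨ preimage-point h j ⟩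
    point h j              ∎)
    where
    f-eq : f (preimage h i) ≡ f (preimage h j)
    f-eq = trans (sym (point-coord f _)) (trans (cong (point f) eq) (point-coord f _))

module IdempotentCoordinates {n} (e : Trans n) (idem : ∀ x → e (e x) ≡ e x) where

  e-point : ∀ y → e (point e y) ≡ point e y
  e-point y = begin
    e (point e y)         ≡⟨ cong e (preimage-point e y) ⟨
    e (e (preimage e y))  ≡⟨ idem (preimage e y) ⟩
    e (preimage e y)      ≡⟨ preimage-point e y ⟩
    point e y             ∎

  coord-unique : ∀ {x y} → e x ≡ point e y → coord e x ≡ y
  coord-unique ex≡y = enum-injective (image e) (trans (point-coord e _) ex≡y)

  coord-point : ∀ y → coord e (point e y) ≡ y
  coord-point y = coord-unique (e-point y)

widen : ∀ {k} d → Trans k → Trans (k + d)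
widen {k} d f = join k d ∘ map₁ f ∘ splitAt k

widen-⨾ : ∀ {k} d (f g : Trans k) → widen d (f ⨾ g) ≗ widen d f ⨾ widen d g
widen-⨾ {k} d f g x = sym (begin
  join k d (map₁ g (splitAt k (join k d (map₁ f (splitAt k x)))))
    ≡⟨ cong (join k d ∘ map₁ g) (splitAt-join k d (map₁ f (splitAt k x))) ⟩
  join k d (map₁ g (map₁ f (splitAt k x)))
    ≡⟨ cong (join k d) (map-map (splitAt k x)) ⟩
  widen d (f ⨾ g) x ∎)

widen-cong : ∀ {k} d {f g : Trans k} → f ≗ g → widen d f ≗ widen d g
widen-cong {k} d f≗g x = cong (join k d) (map₁-cong f≗g (splitAt k x))

widen-id : ∀ {k} d → widen {k} d id ≗ id
widen-id {k} d x = trans (cong (join k d) (map-id (splitAt k x))) (join-splitAt k d x)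

widen-injective : ∀ {k} d {f g : Trans k} → widen d f ≗ widen d g → f ≗ g
widen-injective {k} d {f} {g} eq x = ↑ˡ-injective d (f x) (g x) (begin
  f x ↑ˡ d            ≡⟨ cong (join k d ∘ map₁ f) (splitAt-↑ˡ k x d) ⟨
  widen d f (x ↑ˡ d)  ≡⟨ eq (x ↑ˡ d) ⟩
  widen d g (x ↑ˡ d)  ≡⟨ cong (join k d ∘ map₁ g) (splitAt-↑ˡ k x d) ⟩
  g x ↑ˡ d            ∎)

rank-constant-on-band : ∀ {p q n} (f : RB p q → Trans n) → (∀ b b′ → f (b ∙RB b′) ≗ f b ⨾ f b′)
  → ∀ b b′ → rank (f b) ≡ rank (f b′)
rank-constant-on-band f f-hom b b′ = ≤-antisym (rank-≤-band b b′) (rank-≤-band b′ b)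
  where
  -- b = (b b′) b, so f b factors through f (b b′), which factors through f b′.
  rank-≤-band : ∀ b b′ → rank (f b) ≤ rank (f b′)
  rank-≤-band b b′ =
    ≤-trans (rank-≤ˡ {g = f b} (f-hom (b ∙RB b′) b)) (rank-≤ʳ {f = f b} (f-hom b b′))

module _ {c ℓ} (G : Group c ℓ) where

  open Group G using (Carrier; _≈_; _∙_; ε; identityˡ; identityʳ)

  Unital : ∀ {n} → Embedding _≈_ _∙_ n → Set
  Unital σ = Embedding.φ σ ε ≗ id

  -- σ ε is idempotent and every σ g is fixed by it on both sides, so σ g restricts to
  -- the image of σ ε, where σ ε acts as the identity.
  unitalise : ∀ {n} (σ : Embedding _≈_ _∙_ n) → Σ (Embedding _≈_ _∙_ (rank (Embedding.φ σ ε))) Unital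
  unitalise {n} σ = τ-embedding , λ y → coord-unique (trans (e-absorbˡ ε _) (e-point y))
    where
    open Embedding σ
    e : Trans n
    e = φ ε
    e-absorbˡ : ∀ g x → φ g (e x) ≡ φ g x
    e-absorbˡ g x = trans (sym (φ-hom ε g x)) (φ-cong _ _ (identityˡ g) x)
    e-absorbʳ : ∀ g x → e (φ g x) ≡ φ g x
    e-absorbʳ g x = trans (sym (φ-hom g ε x)) (φ-cong _ _ (identityʳ g) x)
    open IdempotentCoordinates e (e-absorbˡ ε)
    τ : Carrier → Trans (rank e)
    τ g = coord e ∘ φ g ∘ point e
    τ-hom : ∀ g h → τ (g ∙ h) ≗ τ g ⨾ τ h
    τ-hom g h y = cong (coord e) (begin
      φ (g ∙ h) (point e y)                      ≡⟨ φ-hom g h _ ⟩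
      φ h (φ g (point e y))                      ≡⟨ e-absorbˡ h _ ⟨
      φ h (e (φ g (point e y)))                  ≡⟨ cong (φ h) (point-coord e _) ⟨
      φ h (point e (coord e (φ g (point e y))))  ∎)
    φ-via-τ : ∀ g x → φ g x ≡ point e (τ g (coord e x))
    φ-via-τ g x = begin
      φ g x                          ≡⟨ e-absorbʳ g x ⟨
      e (φ g x)                      ≡⟨ cong e (e-absorbˡ g x) ⟨
      e (φ g (e x))                  ≡⟨ cong (e ∘ φ g) (point-coord e x) ⟨
      e (φ g (point e (coord e x)))  ≡⟨ point-coord e _ ⟨
      point e (τ g (coord e x))      ∎
    τ-embedding : Embedding _≈_ _∙_ (rank e)
    τ-embedding = record
      { φ = τ
      ; φ-cong = λ g h g≈h y → cong (coord e) (φ-cong g h g≈h (point e y))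
      ; φ-injective = λ g h τg≗τh → φ-injective g h λ x →
          trans (φ-via-τ g x) (trans (cong (point e) (τg≗τh (coord e x))) (sym (φ-via-τ h x)))
      ; φ-hom = τ-hom
      }

  widen-unital : ∀ {k n} → k ≤ n → Σ (Embedding _≈_ _∙_ k) Unital → Σ (Embedding _≈_ _∙_ n) Unital
  widen-unital {k} k≤n (σ , σ-unital) with m≤n⇒∃[o]m+o≡n k≤n
  ... | d , refl = ρ , λ x → trans (widen-cong d σ-unital x) (widen-id d x)
    where
    open Embedding σ
    ρ : Embedding _≈_ _∙_ (k + d)
    ρ = record
      { φ = widen d ∘ φ
      ; φ-cong = λ g h g≈h → widen-cong d (φ-cong g h g≈h)
      ; φ-injective = λ g h eq → φ-injective g h (widen-injective d eq)
      ; φ-hom = λ g h x → trans (widen-cong d (φ-hom g h) x) (widen-⨾ d (φ g) (φ h) x)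
      }

Least : ∀ {a} → (ℕ → Set a) → ℕ → Set a
Least P n = P n × (∀ k → P k → n ≤ k)

-- With P undecidable the least element exists only up to double negation, which suffices
-- for the decidable goals m ≤ n it is used for.
¬¬-least : ∀ {a} {P : ℕ → Set a} n → P n → ¬ ¬ ∃ (Least P)
¬¬-least {P = P} n Pn no-least = <-rec (λ k → ¬ P k) none-below n Pn
  where
  none-below : ∀ k → (∀ {j} → j < k → ¬ P j) → ¬ P k
  none-below k ih Pk = no-least (k , Pk , λ j Pj → ≮⇒≥ (λ j<k → ih j<k Pj))

module _ {e b q} {E : ℕ → Set e} {Q : ℕ → Set q} {B : ℕ → ℕ → Set b}
         (E⇒B : ∀ n → 1 ≤ n → E n → ∃ λ r → Q r × B r n)
         (B⇒E : ∀ r n → Q r → B r n → 1 ≤ n × E n) where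

  least⇔minimum-of-leasts : ∀ m →
      (1 ≤ m × E m × (∀ n → 1 ≤ n → E n → m ≤ n))
    ⇔ ((∃ λ r → Q r × Least (B r) m) × (∀ r k → Q r → Least (B r) k → m ≤ k))
  least⇔minimum-of-leasts m = mk⇔ to from
    where
    to : 1 ≤ m × E m × (∀ n → 1 ≤ n → E n → m ≤ n)
       → (∃ λ r → Q r × Least (B r) m) × (∀ r k → Q r → Least (B r) k → m ≤ k)
    to (1≤m , Em , m-least) with E⇒B m 1≤m Em
    ... | r , Qr , Brm = (r , Qr , Brm , λ k Brk → uncurry (m-least k) (B⇒E r k Qr Brk))
                       , λ r k Qr (Brk , _) → uncurry (m-least k) (B⇒E r k Qr Brk)
    from : (∃ λ r → Q r × Least (B r) m) × (∀ r k → Q r → Least (B r) k → m ≤ k)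
         → 1 ≤ m × E m × (∀ n → 1 ≤ n → E n → m ≤ n)
    from ((r , Qr , Brm , _) , m-minimum) = proj₁ m-embeds , proj₂ m-embeds , m-least
      where
      m-embeds : 1 ≤ m × E m
      m-embeds = B⇒E r m Qr Brm
      m-least : ∀ n → 1 ≤ n → E n → m ≤ n
      m-least n 1≤n En with E⇒B n 1≤n En
      ... | r′ , Qr′ , Br′n = decidable-stable (m ≤? n) λ m≰n →
        ¬¬-least n Br′n λ (k , Br′k , k-least) →
          m≰n (≤-trans (m-minimum r′ k Qr′ (Br′k , k-least)) (k-least n Br′n))

module RectangularGroup {c ℓ} (G : Group c ℓ) {p q : ℕ} (i₀ : Fin p) (j₀ : Fin q) where

  open Group G using (_≈_; _∙_; ε; _⁻¹; identityˡ; inverseˡ; inverseʳ; ∙-congˡ; ∙-congʳ)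
    renaming (refl to ≈-refl; sym to ≈-sym; trans to ≈-trans)

  S : Set c
  S = RG p q G

  _≋_ : S → S → Set ℓ
  _≋_ = _≈RG_ {p = p} {q = q} {G = G}

  _·_ : S → S → S
  _·_ = mulRG G

  b₀ : RB p q
  b₀ = i₀ , j₀

  module _ {n} (Φ : S → Trans n) (Φ-cong : ∀ X Y → X ≋ Y → Φ X ≗ Φ Y) (Φ-hom : ∀ X Y → Φ (X · Y) ≗ Φ X ⨾ Φ Y)
           {i j i′ j′ g h} (ΦX≗ΦY : Φ ((i , j) , g) ≗ Φ ((i′ , j′) , h)) (g≈h : g ≈ h) where

    private
      X Y Z : S
      X = (i , j) , g
      Y = (i′ , j′) , h
      Z = (i , j) , g ⁻¹

    rows-agree : Φ ((i , j) , ε) ≗ Φ ((i′ , j) , ε)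
    rows-agree x = begin
      Φ ((i , j) , ε) x  ≡⟨ Φ-cong _ _ (refl , ≈-sym (inverseʳ g)) x ⟩
      Φ (X · Z) x        ≡⟨ Φ-hom X Z x ⟩
      Φ Z (Φ X x)        ≡⟨ cong (Φ Z) (ΦX≗ΦY x) ⟩
      Φ Z (Φ Y x)        ≡⟨ Φ-hom Y Z x ⟨
      Φ (Y · Z) x        ≡⟨ Φ-cong _ _ (refl , ≈-trans (∙-congʳ (≈-sym g≈h)) (inverseʳ g)) x ⟩
      Φ ((i′ , j) , ε) x ∎

    columns-agree : Φ ((i , j) , ε) ≗ Φ ((i , j′) , ε)
    columns-agree x = begin
      Φ ((i , j) , ε) x  ≡⟨ Φ-cong _ _ (refl , ≈-sym (inverseˡ g)) x ⟩
      Φ (Z · X) x        ≡⟨ Φ-hom Z X x ⟩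
      Φ X (Φ Z x)        ≡⟨ ΦX≗ΦY (Φ Z x) ⟩
      Φ Y (Φ Z x)        ≡⟨ Φ-hom Z Y x ⟨
      Φ (Z · Y) x        ≡⟨ Φ-cong _ _ (refl , ≈-trans (∙-congˡ (≈-sym g≈h)) (inverseˡ g)) x ⟩
      Φ ((i , j′) , ε) x ∎

  module Restrict {n} (Φ : Embedding _≋_ _·_ n) where

    open Embedding Φ

    band : Embedding {A = RB p q} _≡_ _∙RB_ n
    band = record
      { φ = λ b → φ (b , ε)
      ; φ-cong = λ b b′ b≡b′ → φ-cong _ _ (b≡b′ , ≈-refl)
      ; φ-injective = λ b b′ eq → proj₁ (φ-injective _ _ eq)
      ; φ-hom = λ b b′ x → trans (φ-cong _ _ (refl , ≈-sym (identityˡ ε)) x) (φ-hom (b , ε) (b′ , ε) x)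
      }

    group : Embedding _≈_ _∙_ n
    group = record
      { φ = λ g → φ (b₀ , g)
      ; φ-cong = λ g h g≈h → φ-cong _ _ (refl , g≈h)
      ; φ-injective = λ g h eq → proj₂ (φ-injective _ _ eq)
      ; φ-hom = λ g h → φ-hom (b₀ , g) (b₀ , h)
      }

  embedding⇒bandInDr : ∀ {μG n} → IsDegree _≈_ _∙_ μG → 1 ≤ n → Embedding _≋_ _·_ n
    → ∃ λ r → μG ≤ r × BandInDr p q r n
  embedding⇒bandInDr (_ , _ , μG-least) 1≤n Φ =
    rank (f b₀) ,
    μG-least _ (rank≥1 (f b₀) 1≤n) (proj₁ (unitalise G group)) ,
    band , λ b → rank-constant-on-band f f-hom b b₀
    where
    open Restrict Φ
    open Embedding band renaming (φ to f; φ-hom to f-hom)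

  module Assemble {m} (β : Embedding {A = RB p q} _≡_ _∙RB_ m)
                  (ρ : Embedding _≈_ _∙_ (rank (Embedding.φ β b₀))) (ρ-unital : Unital G ρ) where

    open Embedding β renaming (φ to f; φ-hom to f-hom; φ-injective to f-injective)
    open Embedding ρ renaming (φ to ρ⟨_⟩; φ-cong to ρ-cong; φ-hom to ρ-hom; φ-injective to ρ-injective)

    e : Trans m
    e = f b₀

    open IdempotentCoordinates e (λ x → sym (f-hom b₀ b₀ x))

    fixes-point : ∀ i y → f (i , j₀) (point e y) ≡ point e y
    fixes-point i y = begin
      f (i , j₀) (point e y)      ≡⟨ cong (f (i , j₀)) (e-point y) ⟨
      f (i , j₀) (e (point e y))  ≡⟨ f-hom b₀ (i , j₀) _ ⟨
      e (point e y)               ≡⟨ e-point y ⟩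
      point e y                   ∎

    F : S → Trans m
    F ((i , j) , g) x = f (i₀ , j) (point e (ρ⟨ g ⟩ (coord e (f (i , j₀) x))))

    coord-through : ∀ i j y → coord e (f (i , j₀) (f (i₀ , j) (point e y))) ≡ y
    coord-through i j y = coord-unique (begin
      e (f (i , j₀) (f (i₀ , j) (point e y)))  ≡⟨ cong e (f-hom (i₀ , j) (i , j₀) _) ⟨
      e (e (point e y))                        ≡⟨ cong e (e-point y) ⟩
      e (point e y)                            ≡⟨ e-point y ⟩
      point e y                                ∎)

    F-hom : ∀ X Y → F (X · Y) ≗ F X ⨾ F Y
    F-hom ((i , j) , g) ((i′ , j′) , h) x = cong (f (i₀ , j′) ∘ point e)
      (trans (ρ-hom g h _) (cong ρ⟨ h ⟩ (sym (coord-through i′ j _))))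

    F-cong : ∀ X Y → X ≋ Y → F X ≗ F Y
    F-cong ((i , j) , g) (_ , h) (refl , g≈h) x = cong (f (i₀ , j) ∘ point e) (ρ-cong g h g≈h _)

    F-band : ∀ i j → F ((i , j) , ε) ≗ f (i , j)
    F-band i j x = begin
      f (i₀ , j) (point e (ρ⟨ ε ⟩ (coord e (f (i , j₀) x))))  ≡⟨ cong (f (i₀ , j) ∘ point e) (ρ-unital _) ⟩
      f (i₀ , j) (point e (coord e (f (i , j₀) x)))           ≡⟨ cong (f (i₀ , j)) (point-coord e _) ⟩
      f (i₀ , j) (e (f (i , j₀) x))                           ≡⟨ cong (f (i₀ , j)) (f-hom (i , j₀) b₀ x) ⟨
      f (i₀ , j) (f (i , j₀) x)                               ≡⟨ f-hom (i , j₀) (i₀ , j) x ⟨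
      f (i , j) x                                             ∎

    F-group : ∀ i j g y → coord e (F ((i , j) , g) (point e y)) ≡ ρ⟨ g ⟩ y
    F-group i j g y = coord-unique (begin
      e (f (i₀ , j) (point e (ρ⟨ g ⟩ (coord e (f (i , j₀) (point e y))))))
        ≡⟨ f-hom (i₀ , j) b₀ _ ⟨
      e (point e (ρ⟨ g ⟩ (coord e (f (i , j₀) (point e y)))))
        ≡⟨ e-point _ ⟩
      point e (ρ⟨ g ⟩ (coord e (f (i , j₀) (point e y))))
        ≡⟨ cong (point e ∘ ρ⟨ g ⟩) (trans (cong (coord e) (fixes-point i y)) (coord-point y)) ⟩
      point e (ρ⟨ g ⟩ y) ∎)

    F-injective : ∀ X Y → F X ≗ F Y → X ≋ Y
    F-injective ((i , j) , g) ((i′ , j′) , h) FX≗FY = cong₂ _,_ i≡i′ j≡j′ , g≈h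
      where
      g≈h : g ≈ h
      g≈h = ρ-injective g h λ y →
        trans (sym (F-group i j g y)) (trans (cong (coord e) (FX≗FY (point e y))) (F-group i′ j′ h y))
      i≡i′ : i ≡ i′
      i≡i′ = cong proj₁ (f-injective _ _ λ x →
        trans (sym (F-band i j x)) (trans (rows-agree F F-cong F-hom FX≗FY g≈h x) (F-band i′ j x)))
      j≡j′ : j ≡ j′
      j≡j′ = cong proj₂ (f-injective _ _ λ x →
        trans (sym (F-band i j x)) (trans (columns-agree F F-cong F-hom FX≗FY g≈h x) (F-band i j′ x)))

    assembled : Embedding _≋_ _·_ m
    assembled = record { φ = F ; φ-cong = F-cong ; φ-injective = F-injective ; φ-hom = F-hom }

  bandInDr⇒embedding : ∀ {μG r m} → IsDegree _≈_ _∙_ μG → μG ≤ r → BandInDr p q r m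
    → 1 ≤ m × Embedding _≋_ _·_ m
  bandInDr⇒embedding {μG} (1≤μG , σ , _) μG≤r (β , rank≡r) =
    ≤-trans 1≤μG (≤-trans μG≤R (rank-≤ (f b₀))) ,
    Assemble.assembled β (proj₁ ρ) (proj₂ ρ)
    where
    open Embedding β renaming (φ to f)
    μG≤R : μG ≤ rank (f b₀)
    μG≤R = subst (μG ≤_) (sym (rank≡r b₀)) μG≤r
    ρ : Σ (Embedding _≈_ _∙_ (rank (f b₀))) (Unital G)
    ρ = widen-unital G (≤-trans (rank-≤ (Embedding.φ σ ε)) μG≤R) (unitalise G σ)

theorem3p12 : ∀ {c ℓ} (p q : ℕ) (G : Group c ℓ) → 1 ≤ p → 1 ≤ q → FiniteGroup G
    → (μG : ℕ) → IsDegree (Group._≈_ G) (Group._∙_ G) μG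
    → (m : ℕ) → IsDegree (_≈RG_ {p = p} {q = q} {G = G}) (mulRG G) m ⇔ IsMinBeta μG p q m
theorem3p12 (suc p) (suc q) G _ _ _ μG μG-degree =
  least⇔minimum-of-leasts (λ n → embedding⇒bandInDr μG-degree) (λ r n → bandInDr⇒embedding μG-degree)
  where open RectangularGroup G {suc p} {suc q} zero zero
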